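{- If $\Lambda$ is one of the root lattices $A_n$ with $n\ge1$, $n\neq2$, or $D_n$ with $n\ge1$, $n\ne4$, or $E_7$, then the orthogonal automorphism group $\operatorname{Aut}(\Lambda)$ contains no automorphism with minimal polynomial $X^2-X+1$.
   Context: The root lattices are the standard ones: $A_n=\{x\in\mathbb{Z}^{n+1}:\sum x_i=0\}$, $D_n=\{x\in\mathbb{Z}^n:\sum x_i\equiv0\pmod 2\}$, and $E_7$ the exceptional root lattice of rank $7$, each with the standard Euclidean inner product. $\operatorname{Aut}(\Lambda)$ is the group of $\mathbb{Z}$-linear bijections of $\Lambda$ preserving the inner product. -}

module Defs where

open import Data.Nat as ℕ using (ℕ; zero; suc)
open import Data.Integer as ℤ using (ℤ; +_; _+_; _*_; -_)
open import Data.Integer.Divisibility using (_∣_)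
open import Data.Vec using (Vec; []; _∷_; zipWith; map; replicate)
open import Data.Vec.Relation.Unary.All using (All)
open import Data.List using (List; []; _∷_; length)
open import Data.List.Relation.Unary.All as LAll using ()
open import Data.Product using (Σ; _×_; _,_)
open import Data.Sum using (_⊎_)
open import Relation.Binary.PropositionalEquality using (_≡_)

Vecℤ : ℕ → Set
Vecℤ m = Vec ℤ m

vsum : ∀ {m} → Vecℤ m → ℤ
vsum []       = + 0
vsum (x ∷ xs) = x + vsum xs

_⊕_ : ∀ {m} → Vecℤ m → Vecℤ m → Vecℤ m
_⊕_ = zipWith _+_

_⊙_ : ∀ {m} → ℤ → Vecℤ m → Vecℤ m
k ⊙ v = map (k *_) v

zeroV : ∀ {m} → Vecℤ m
zeroV {m} = replicate m (+ 0)

dot : ∀ {m} → Vecℤ m → Vecℤ m → ℤ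
dot x y = vsum (zipWith _*_ x y)

-- A lattice given concretely as a subgroup of ℤ^dim (membership predicate),
-- with the standard inner product of ℤ^dim.
record Lattice : Set₁ where
  field
    dim    : ℕ
    member : Vecℤ dim → Set
open Lattice public

A : ℕ → Lattice
A n = record { dim = suc n ; member = λ x → vsum x ≡ + 0 }

D : ℕ → Lattice
D n = record { dim = n ; member = λ x → (+ 2) ∣ vsum x }

-- E_7 = {x ∈ E_8 : Σ x_i = 0}, where E_8 = D_8 ∪ (D_8 + (1/2,…,1/2)).
-- Represented by y = 2x ∈ ℤ^8: all y_i even or all y_i odd, and Σ y_i = 0
-- (which forces Σ x_i = 0, in particular even).  The inner product of the
-- represented vectors is 4 times the true one; this does not affect which
-- maps preserve it.
E7 : Lattice
E7 = record
  { dim = 8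
  ; member = λ y → vsum y ≡ + 0 ×
                   (All (λ c → (+ 2) ∣ c) y ⊎ All (λ c → (+ 2) ∣ (c + + 1)) y) }

-- Orthogonal automorphism of Λ: a ℤ-linear bijection Λ → Λ preserving the
-- inner product.  Given as a map on ℤ^dim; only its behaviour on Λ matters.
record Aut (Λ : Lattice) : Set where
  field
    fun       : Vecℤ (dim Λ) → Vecℤ (dim Λ)
    closed    : ∀ x → member Λ x → member Λ (fun x)
    additive  : ∀ x y → member Λ x → member Λ y → fun (x ⊕ y) ≡ fun x ⊕ fun y
    homog     : ∀ (k : ℤ) x → member Λ x → fun (k ⊙ x) ≡ k ⊙ fun x
    injective : ∀ x y → member Λ x → member Λ y → fun x ≡ fun y → x ≡ y
    surjective : ∀ y → member Λ y → Σ (Vecℤ (dim Λ)) (λ x → member Λ x × fun x ≡ y)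
    isometry  : ∀ x y → member Λ x → member Λ y → dot (fun x) (fun y) ≡ dot x y
open Aut public

-- Polynomials with integer coefficients, as coefficient lists (constant term first).
Poly : Set
Poly = List ℤ

iter : ∀ {m} → ℕ → (Vecℤ m → Vecℤ m) → Vecℤ m → Vecℤ m
iter zero    f x = x
iter (suc k) f x = f (iter k f x)

evalAt : ∀ {m} → ℕ → Poly → (Vecℤ m → Vecℤ m) → Vecℤ m → Vecℤ m
evalAt i []       f x = zeroV
evalAt i (c ∷ cs) f x = (c ⊙ iter i f x) ⊕ evalAt (suc i) cs f x

evalPoly : ∀ {m} → Poly → (Vecℤ m → Vecℤ m) → Vecℤ m → Vecℤ m
evalPoly = evalAt 0

Annihilates : (Λ : Lattice) → Poly → Aut Λ → Set
Annihilates Λ p g = ∀ x → member Λ x → evalPoly p (fun g) x ≡ zeroV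

Monic : Poly → Set
Monic []           = Data.Empty.⊥ where import Data.Empty
Monic (c ∷ [])     = c ≡ + 1
Monic (c ∷ d ∷ cs) = Monic (d ∷ cs)

-- p is the minimal polynomial of g: p is monic, p(g) = 0 on Λ, and every
-- polynomial of smaller degree annihilating g is the zero polynomial.
-- (Over ℚ vs ℤ coefficients makes no difference: clear denominators.)
IsMinPoly : (Λ : Lattice) → Aut Λ → Poly → Set
IsMinPoly Λ g p =
  Monic p × Annihilates Λ p g ×
  (∀ (q : Poly) → length q ℕ.< length p → Annihilates Λ q g →
     LAll.All (λ c → c ≡ + 0) q)

cyc6 : Poly
cyc6 = + 1 ∷ - (+ 1) ∷ + 1 ∷ []

{-# OPTIONS --safe #-}
-- If g is an isometry with g² − g + 1 = 0, pairing x − gx + g²x = 0 with gx gives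
-- 2⟨x, gx⟩ = ⟨x, x⟩.  Take a probe vector y whose inner products with the whole lattice
-- are divisible by d; then so are those of gy, which makes all coordinates of gy
-- congruent mod d, while 2⟨y, gy⟩ = ⟨y, y⟩ fixes its first coordinate.
-- For Dₙ (y = 2e₁, d = 2) all coordinates of gy are odd, so 4 = ⟨gy, gy⟩ ≡ n (mod 4)
-- with n ≤ 4.  For Aₙ (y = (n, −1, …, −1), d = n + 1) one gets n = 2m and every
-- coordinate c ≡ m (mod 2m + 1), hence c² + c ≥ m(m + 1) and
-- (n + 1) m (m + 1) ≤ ⟨gy, gy⟩ + Σ gy = n (n + 1) = 2m (n + 1), so m ≤ 1.
-- For E₇ a norm-6 vector y has even inner product with every lattice vector,
-- yet 2⟨y, gy⟩ = 6.
module Submission where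

open import Defs
open import Data.Nat using (ℕ; _≤_)
open import Relation.Binary.PropositionalEquality using (_≢_)
open import Data.Product using (Σ; _×_)
open import Relation.Nullary using (¬_)

open import Data.Nat as ℕ using (zero; suc)
import Data.Nat.Properties as ℕ
import Data.Nat.Divisibility as ℕ
import Data.Nat.Tactic.RingSolver as ℕ
open import Data.Integer as ℤ using (ℤ; +_; -[1+_]; _+_; _*_; -_; _-_)
import Data.Integer.Properties as ℤ
open import Data.Integer.Tactic.RingSolver using (solve-∀)
import Data.Integer.Divisibility as Unsigned
open import Data.Integer.Divisibility.Signed
  using (_∣_; divides; ∣ᵤ⇒∣; ∣⇒∣ᵤ; ∣-refl; ∣m∣n⇒∣m+n; ∣m∣n⇒∣m-n; ∣m⇒∣m*n)
open import Data.Vec using (Vec; []; _∷_; replicate)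
open import Data.Vec.Relation.Unary.All using (All; []; _∷_)
open import Data.Product using (_,_; proj₁; proj₂)
open import Data.Sum using (_⊎_; inj₁; inj₂)
import Data.Sum
open import Data.Empty using (⊥-elim)
open import Relation.Nullary.Decidable using (from-no)
open import Relation.Binary.PropositionalEquality
  using (_≡_; refl; sym; trans; cong; cong₂; subst; subst₂; module ≡-Reasoning)

open ≡-Reasoning

vsum-zeroV : ∀ m → vsum (zeroV {m}) ≡ + 0
vsum-zeroV zero    = refl
vsum-zeroV (suc m) = cong (_+_ (+ 0)) (vsum-zeroV m)

dot-comm : ∀ {m} (x y : Vecℤ m) → dot x y ≡ dot y x
dot-comm []      []      = refl
dot-comm (a ∷ x) (b ∷ y) = cong₂ _+_ (ℤ.*-comm a b) (dot-comm x y)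

dot-zeroˡ : ∀ {m} (x : Vecℤ m) → dot zeroV x ≡ + 0
dot-zeroˡ []      = refl
dot-zeroˡ (a ∷ x) = cong (_+_ ((+ 0) * a)) (dot-zeroˡ x)

dot-zeroʳ : ∀ {m} (x : Vecℤ m) → dot x zeroV ≡ + 0
dot-zeroʳ x = trans (dot-comm x zeroV) (dot-zeroˡ x)

dot-⊕ˡ : ∀ {m} (x y z : Vecℤ m) → dot (x ⊕ y) z ≡ dot x z + dot y z
dot-⊕ˡ []      []      []      = refl
dot-⊕ˡ (a ∷ x) (b ∷ y) (c ∷ z) = begin
  (a + b) * c + dot (x ⊕ y) z       ≡⟨ cong (_+_ ((a + b) * c)) (dot-⊕ˡ x y z) ⟩
  (a + b) * c + (dot x z + dot y z) ≡⟨ shuffle a b c (dot x z) (dot y z) ⟩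
  (a * c + dot x z) + (b * c + dot y z) ∎
  where
  shuffle : ∀ a b c s t → (a + b) * c + (s + t) ≡ (a * c + s) + (b * c + t)
  shuffle = solve-∀

dot-⊙ˡ : ∀ {m} k (x y : Vecℤ m) → dot (k ⊙ x) y ≡ k * dot x y
dot-⊙ˡ k []      []      = sym (ℤ.*-zeroʳ k)
dot-⊙ˡ k (a ∷ x) (b ∷ y) = begin
  k * a * b + dot (k ⊙ x) y ≡⟨ cong (_+_ (k * a * b)) (dot-⊙ˡ k x y) ⟩
  k * a * b + k * dot x y   ≡⟨ distrib k a b (dot x y) ⟩
  k * (a * b + dot x y)     ∎
  where
  distrib : ∀ k a b s → k * a * b + k * s ≡ k * (a * b + s)
  distrib = solve-∀

dot-cyc6ˡ : ∀ {m} (f : Vecℤ m → Vecℤ m) x y →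
            dot (evalPoly cyc6 f x) y ≡ dot x y - dot (f x) y + dot (f (f x)) y
dot-cyc6ˡ f x y = begin
  dot (a ⊕ (b ⊕ (c ⊕ zeroV))) y                 ≡⟨ dot-⊕ˡ a (b ⊕ (c ⊕ zeroV)) y ⟩
  dot a y + dot (b ⊕ (c ⊕ zeroV)) y             ≡⟨ cong (_+_ (dot a y)) (dot-⊕ˡ b (c ⊕ zeroV) y) ⟩
  dot a y + (dot b y + dot (c ⊕ zeroV) y)       ≡⟨ cong (λ s → dot a y + (dot b y + s)) (dot-⊕ˡ c zeroV y) ⟩
  dot a y + (dot b y + (dot c y + dot zeroV y))
    ≡⟨ cong₂ _+_ (dot-⊙ˡ (+ 1) x y)
         (cong₂ _+_ (dot-⊙ˡ (- (+ 1)) (f x) y)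
           (cong₂ _+_ (dot-⊙ˡ (+ 1) (f (f x)) y) (dot-zeroˡ y))) ⟩
  + 1 * dot x y + (- (+ 1) * dot (f x) y + (+ 1 * dot (f (f x)) y + + 0))
    ≡⟨ normalise (dot x y) (dot (f x) y) (dot (f (f x)) y) ⟩
  dot x y - dot (f x) y + dot (f (f x)) y ∎
  where
  a b c : Vecℤ _
  a = (+ 1) ⊙ x
  b = (- (+ 1)) ⊙ f x
  c = (+ 1) ⊙ f (f x)
  normalise : ∀ a b c → + 1 * a + (- (+ 1) * b + (+ 1 * c + + 0)) ≡ a - b + c
  normalise = solve-∀

DotsDivisibleBy : (Λ : Lattice) → ℤ → Vecℤ (dim Λ) → Set
DotsDivisibleBy Λ d w = ∀ z → member Λ z → d ∣ dot w z

module _ {Λ : Lattice} (g : Aut Λ) where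

  twice-dot-image≡norm : Annihilates Λ cyc6 g → ∀ {x} → member Λ x →
                         dot x (fun g x) + dot x (fun g x) ≡ dot x x
  twice-dot-image≡norm ann {x} x∈Λ = begin
    p + p                       ≡⟨ regroup p (dot x x) ⟩
    (p - dot x x + p) + dot x x ≡⟨ cong (_+ dot x x) vanishes ⟩
    + 0 + dot x x               ≡⟨ ℤ.+-identityˡ (dot x x) ⟩
    dot x x                     ∎
    where
    gx = fun g x
    p  = dot x gx
    regroup : ∀ p n → p + p ≡ (p - n + p) + n
    regroup = solve-∀
    vanishes : p - dot x x + p ≡ + 0
    vanishes = begin
      p - dot x x + p
        ≡⟨ cong₂ (λ a b → p - a + b) (sym (isometry g x x x∈Λ x∈Λ))
             (trans (dot-comm x gx) (sym (isometry g gx x (closed g x x∈Λ) x∈Λ))) ⟩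
      dot x gx - dot gx gx + dot (fun g gx) gx ≡⟨ sym (dot-cyc6ˡ (fun g) x gx) ⟩
      dot (evalPoly cyc6 (fun g) x) gx         ≡⟨ cong (λ v → dot v gx) (ann x x∈Λ) ⟩
      dot zeroV gx                             ≡⟨ dot-zeroˡ gx ⟩
      + 0                                      ∎

  image-DotsDivisibleBy : ∀ {d y} → member Λ y → DotsDivisibleBy Λ d y →
                          DotsDivisibleBy Λ d (fun g y)
  image-DotsDivisibleBy {d} {y} y∈Λ y∣ z z∈Λ with surjective g z z∈Λ
  ... | z′ , z′∈Λ , refl = subst (d ∣_) (sym (isometry g y z′ y∈Λ z′∈Λ)) (y∣ z′ z′∈Λ)

-- Testing against e₀ - eᵢ, which lies in any lattice {z : P (Σ z)} with P 0.
coordinates≡head-mod : (P : ℤ → Set) → P (+ 0) → ∀ {d} h {k} (t : Vecℤ k) →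
                       (∀ z → P (vsum z) → d ∣ dot (h ∷ t) z) →
                       All (λ c → d ∣ h - c) (h ∷ t)
coordinates≡head-mod P P0 {d} h t h∷t∣ =
  subst (d ∣_) (sym (ℤ.+-inverseʳ h)) (divides (+ 0) refl) ∷ tail t (λ a u → h∷t∣ (a ∷ u))
  where
  tail : ∀ {k} (t : Vecℤ k) → (∀ a u → P (a + vsum u) → d ∣ h * a + dot t u) →
         All (λ c → d ∣ h - c) t
  tail []      _  = []
  tail {suc k} (c ∷ t) c∷t∣ = head∣ ∷ tail t (λ a u Pau → subst (d ∣_) (drop-c h a c (dot t u))
                                                (c∷t∣ a (+ 0 ∷ u) (subst P (pad a (vsum u)) Pau)))
    where
    probe : + 1 + (- (+ 1) + vsum (zeroV {k})) ≡ + 0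
    probe = cong (λ s → + 1 + (- (+ 1) + s)) (vsum-zeroV k)
    tested : h * + 1 + (c * - (+ 1) + dot t zeroV) ≡ h - c
    tested = trans (cong (λ s → h * + 1 + (c * - (+ 1) + s)) (dot-zeroʳ t)) (normalise h c)
      where normalise : ∀ h c → h * + 1 + (c * - (+ 1) + + 0) ≡ h - c
            normalise = solve-∀
    head∣ : d ∣ h - c
    head∣ = subst (d ∣_) tested (c∷t∣ (+ 1) (- (+ 1) ∷ zeroV) (subst P (sym probe) P0))
    drop-c : ∀ h a c s → h * a + (c * + 0 + s) ≡ h * a + s
    drop-c = solve-∀
    pad : ∀ a s → a + s ≡ a + (+ 0 + s)
    pad = solve-∀

q*[q-1]≡+ : ∀ q → Σ ℕ λ j → q * (q - + 1) ≡ + j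
q*[q-1]≡+ (+ zero)  = 0 , refl
q*[q-1]≡+ (+ suc n) = suc n ℕ.* n , trans (cong (+ suc n *_) (pred≡ n)) (sym (ℤ.pos-* (suc n) n))
  where pred≡ : ∀ n → + suc n - + 1 ≡ + n
        pred≡ zero    = refl
        pred≡ (suc n) = refl
q*[q-1]≡+ -[1+ n ]  = _ , refl

-- With d = b + 2a and c = a - q d one gets c² + b c = a² + b a + d² q (q - 1).
square-congruence : ∀ a b c → + (b ℕ.+ (a ℕ.+ a)) ∣ + a - c →
                    Σ ℕ λ j → c * c + + b * c ≡
                              + (a ℕ.* a ℕ.+ b ℕ.* a ℕ.+ (b ℕ.+ (a ℕ.+ a)) ℕ.* (b ℕ.+ (a ℕ.+ a)) ℕ.* j)
square-congruence a b c (divides q a-c≡qd) with q*[q-1]≡+ q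
... | j , q[q-1]≡j = j , (begin
  c * c + + b * c                                 ≡⟨ cong (λ x → x * x + + b * x) c≡a-qd ⟩
  (+ a - q * + d) * (+ a - q * + d) + + b * (+ a - q * + d) ≡⟨ expand (+ a) (+ b) q ⟩
  (+ a * + a + + b * + a) + + d * + d * (q * (q - + 1))  ≡⟨ cong (λ x → (+ a * + a + + b * + a) + + d * + d * x) q[q-1]≡j ⟩
  (+ a * + a + + b * + a) + + d * + d * + j
    ≡⟨ cong₂ _+_ (cong₂ _+_ (sym (ℤ.pos-* a a)) (sym (ℤ.pos-* b a)))
                 (trans (cong (_* + j) (sym (ℤ.pos-* d d))) (sym (ℤ.pos-* (d ℕ.* d) j))) ⟩
  + (a ℕ.* a ℕ.+ b ℕ.* a ℕ.+ d ℕ.* d ℕ.* j)     ∎)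
  where
  d = b ℕ.+ (a ℕ.+ a)
  c≡a-[a-c] : ∀ a c → c ≡ a - (a - c)
  c≡a-[a-c] = solve-∀
  c≡a-qd : c ≡ + a - q * + d
  c≡a-qd = trans (c≡a-[a-c] (+ a) c) (cong (_-_ (+ a)) a-c≡qd)
  expand : ∀ h e q → (h - q * (e + (h + h))) * (h - q * (e + (h + h))) + e * (h - q * (e + (h + h))) ≡
                     (h * h + e * h) + (e + (h + h)) * (e + (h + h)) * (q * (q - + 1))
  expand = solve-∀

norm-congruence : ∀ a b {k} (w : Vecℤ k) → All (λ c → + (b ℕ.+ (a ℕ.+ a)) ∣ + a - c) w →
                  Σ ℕ λ J → dot w w + + b * vsum w ≡
                            + (k ℕ.* (a ℕ.* a ℕ.+ b ℕ.* a) ℕ.+ (b ℕ.+ (a ℕ.+ a)) ℕ.* (b ℕ.+ (a ℕ.+ a)) ℕ.* J)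
norm-congruence a b [] [] =
  0 , trans (ℤ.+-identityˡ (+ b * + 0)) (trans (ℤ.*-zeroʳ (+ b)) (cong +_ (sym (ℕ.*-zeroʳ ((b ℕ.+ (a ℕ.+ a)) ℕ.* (b ℕ.+ (a ℕ.+ a)))))))
norm-congruence a b {suc k} (c ∷ w) (c≡ ∷ w≡)
  with square-congruence a b c c≡ | norm-congruence a b w w≡
... | j , c-eq | J , w-eq = j ℕ.+ J , (begin
  (c * c + dot w w) + + b * (c + vsum w)     ≡⟨ regroup (c * c) (dot w w) (+ b) c (vsum w) ⟩
  (c * c + + b * c) + (dot w w + + b * vsum w) ≡⟨ cong₂ _+_ c-eq w-eq ⟩
  + ((H ℕ.+ dd ℕ.* j) ℕ.+ (k ℕ.* H ℕ.+ dd ℕ.* J)) ≡⟨ cong +_ (collect H dd k j J) ⟩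
  + (suc k ℕ.* H ℕ.+ dd ℕ.* (j ℕ.+ J))      ∎)
  where
  H  = a ℕ.* a ℕ.+ b ℕ.* a
  dd = (b ℕ.+ (a ℕ.+ a)) ℕ.* (b ℕ.+ (a ℕ.+ a))
  regroup : ∀ p q e c s → (p + q) + e * (c + s) ≡ (p + e * c) + (q + e * s)
  regroup = solve-∀
  collect : ∀ H dd k j J → (H ℕ.+ dd ℕ.* j) ℕ.+ (k ℕ.* H ℕ.+ dd ℕ.* J) ≡ suc k ℕ.* H ℕ.+ dd ℕ.* (j ℕ.+ J)
  collect = ℕ.solve-∀

rank+4J≡4⇒rank≡4 : ∀ k J → suc k ℕ.* 1 ℕ.+ 4 ℕ.* J ≡ 4 → suc k ≡ 4
rank+4J≡4⇒rank≡4 k zero    eq = trans (sym (ℕ.*-identityʳ (suc k))) (trans (sym (ℕ.+-identityʳ _)) eq)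
rank+4J≡4⇒rank≡4 k (suc J) eq = ⊥-elim (ℕ.<-irrefl refl (subst (5 ℕ.≤_) eq
  (ℕ.s≤s (ℕ.≤-trans (ℕ.m≤m*n 4 (suc J)) (ℕ.m≤n+m (4 ℕ.* suc J) (k ℕ.* 1))))))

D-probe : ∀ n → Vecℤ (suc n)
D-probe n = + 2 ∷ zeroV

dot-D-probe : ∀ {n} a (u : Vecℤ n) → dot (D-probe n) (a ∷ u) ≡ + 2 * a
dot-D-probe a u = trans (cong (_+_ (+ 2 * a)) (dot-zeroˡ u)) (ℤ.+-identityʳ (+ 2 * a))

D-probe∈D : ∀ n → member (D (suc n)) (D-probe n)
D-probe∈D n = subst (+ 2 Unsigned.∣_) (sym (cong (_+_ (+ 2)) (vsum-zeroV n))) (Unsigned.divides 1 refl)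

D-probe-DotsDivisibleBy-2 : ∀ n → DotsDivisibleBy (D (suc n)) (+ 2) (D-probe n)
D-probe-DotsDivisibleBy-2 n (a ∷ u) _ = subst (+ 2 ∣_) (sym (dot-D-probe a u)) (∣m⇒∣m*n a ∣-refl)

D-image-rank≡4 : ∀ n (w : Vecℤ (suc n)) →
                 dot (D-probe n) w + dot (D-probe n) w ≡ + 4 →
                 DotsDivisibleBy (D (suc n)) (+ 2) w → dot w w ≡ + 4 → suc n ≡ 4
D-image-rank≡4 n (w₀ ∷ t) twice w∣ ww with w₀≡1
  where
  w₀≡1 : w₀ ≡ + 1
  w₀≡1 = ℤ.*-cancelˡ-≡ (+ 4) w₀ (+ 1)
           (trans (double w₀) (trans (cong₂ _+_ (sym (dot-D-probe w₀ t)) (sym (dot-D-probe w₀ t))) twice))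
    where double : ∀ a → + 4 * a ≡ + 2 * a + + 2 * a
          double = solve-∀
... | refl with norm-congruence 1 0 (+ 1 ∷ t)
                  (coordinates≡head-mod (+ 2 Unsigned.∣_) (Unsigned.divides 0 refl) (+ 1) t w∣)
... | J , norm≡ = rank+4J≡4⇒rank≡4 n J (ℤ.+-injective (begin
  + (suc n ℕ.* 1 ℕ.+ 4 ℕ.* J)   ≡⟨ norm≡ ⟨
  ww′ + + 0 * vsum (+ 1 ∷ t)    ≡⟨ cong (_+_ ww′) (ℤ.*-zeroˡ (vsum (+ 1 ∷ t))) ⟩
  ww′ + + 0                     ≡⟨ ℤ.+-identityʳ ww′ ⟩
  ww′                           ≡⟨ ww ⟩
  + 4                           ∎))
  where ww′ = dot (+ 1 ∷ t) (+ 1 ∷ t)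

D-cyc6⇒rank≡4 : ∀ n (g : Aut (D (suc n))) → Annihilates (D (suc n)) cyc6 g → suc n ≡ 4
D-cyc6⇒rank≡4 n g ann =
  D-image-rank≡4 n (fun g v) (trans (twice-dot-image≡norm g ann v∈D) v·v≡4)
    (image-DotsDivisibleBy g v∈D (D-probe-DotsDivisibleBy-2 n)) (trans (isometry g v v v∈D v∈D) v·v≡4)
  where
  v   = D-probe n
  v∈D = D-probe∈D n
  v·v≡4 : dot v v ≡ + 4
  v·v≡4 = dot-D-probe {n} (+ 2) zeroV

vsum-replicate-neg1 : ∀ k → vsum (replicate k (- (+ 1))) ≡ - (+ k)
vsum-replicate-neg1 zero    = refl
vsum-replicate-neg1 (suc k) = begin
  - (+ 1) + vsum (replicate k (- (+ 1))) ≡⟨ cong (_+_ (- (+ 1))) (vsum-replicate-neg1 k) ⟩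
  - (+ 1) + - (+ k)                      ≡⟨ ℤ.neg-distrib-+ (+ 1) (+ k) ⟨
  - (+ suc k)                            ∎

dot-replicate-neg1 : ∀ {k} (u : Vecℤ k) → dot (replicate k (- (+ 1))) u ≡ - vsum u
dot-replicate-neg1 []      = refl
dot-replicate-neg1 (c ∷ u) = begin
  - (+ 1) * c + dot (replicate _ (- (+ 1))) u ≡⟨ cong (_+_ (- (+ 1) * c)) (dot-replicate-neg1 u) ⟩
  - (+ 1) * c + - vsum u                      ≡⟨ negate c (vsum u) ⟩
  - (c + vsum u)                              ∎
  where negate : ∀ c s → - (+ 1) * c + - s ≡ - (c + s)
        negate = solve-∀

A-probe : ∀ n → Vecℤ (suc n)
A-probe n = + n ∷ replicate n (- (+ 1))

A-probe∈A : ∀ n → member (A n) (A-probe n)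
A-probe∈A n = trans (cong (_+_ (+ n)) (vsum-replicate-neg1 n)) (ℤ.+-inverseʳ (+ n))

dot-A-probe : ∀ n a (u : Vecℤ n) → member (A n) (a ∷ u) → dot (A-probe n) (a ∷ u) ≡ + suc n * a
dot-A-probe n a u a+u≡0 = begin
  + n * a + dot (replicate n (- (+ 1))) u ≡⟨ cong (_+_ (+ n * a)) (dot-replicate-neg1 u) ⟩
  + n * a + - vsum u                      ≡⟨ rearrange (+ n) a (vsum u) ⟩
  (+ 1 + + n) * a - (a + vsum u)          ≡⟨ cong (_-_ ((+ 1 + + n) * a)) a+u≡0 ⟩
  (+ 1 + + n) * a - + 0                   ≡⟨ ℤ.+-identityʳ _ ⟩
  + suc n * a                             ∎
  where rearrange : ∀ n a s → n * a + - s ≡ (+ 1 + n) * a - (a + s)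
        rearrange = solve-∀

A-probe-norm : ∀ n → dot (A-probe n) (A-probe n) ≡ + (suc n ℕ.* n)
A-probe-norm n = trans (dot-A-probe n (+ n) _ (A-probe∈A n)) (sym (ℤ.pos-* (suc n) n))

A-probe-DotsDivisibleBy-rank+1 : ∀ n → DotsDivisibleBy (A n) (+ suc n) (A-probe n)
A-probe-DotsDivisibleBy-rank+1 n (a ∷ u) z∈A =
  subst (+ suc n ∣_) (sym (dot-A-probe n a u z∈A)) (∣m⇒∣m*n a ∣-refl)

half : ∀ w n → w + w ≡ + n → Σ ℕ λ m → w ≡ + m × m ℕ.+ m ≡ n
half (+ m)    n eq = m , refl , ℤ.+-injective eq
half -[1+ _ ] n ()

m[m+1]≤2m⇒m≤1 : ∀ m → m ℕ.* m ℕ.+ 1 ℕ.* m ℕ.≤ m ℕ.+ m → m ≡ 0 ⊎ m ≡ 1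
m[m+1]≤2m⇒m≤1 zero          _  = inj₁ refl
m[m+1]≤2m⇒m≤1 (suc zero)    _  = inj₂ refl
m[m+1]≤2m⇒m≤1 (suc (suc k)) le = ⊥-elim (2+k≰1 (ℕ.*-cancelˡ-≤ m m*m≤m*1))
  where
  m = suc (suc k)
  2+k≰1 : ¬ m ℕ.≤ 1
  2+k≰1 (ℕ.s≤s ())
  m*m≤m*1 : m ℕ.* m ℕ.≤ m ℕ.* 1
  m*m≤m*1 = subst₂ ℕ._≤_ refl (sym (ℕ.*-identityʳ m))
              (ℕ.+-cancelʳ-≤ m (m ℕ.* m) m (subst₂ ℕ._≤_ (cong (ℕ._+_ (m ℕ.* m)) (ℕ.+-identityʳ m)) refl le))

A-first≡half : ∀ n w₀ (t : Vecℤ n) → member (A n) (w₀ ∷ t) →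
               dot (A-probe n) (w₀ ∷ t) + dot (A-probe n) (w₀ ∷ t) ≡ + (suc n ℕ.* n) → w₀ + w₀ ≡ + n
A-first≡half n w₀ t w∈A twice = ℤ.*-cancelˡ-≡ (+ suc n) (w₀ + w₀) (+ n) (begin
  + suc n * (w₀ + w₀)                                 ≡⟨ ℤ.*-distribˡ-+ (+ suc n) w₀ w₀ ⟩
  + suc n * w₀ + + suc n * w₀                         ≡⟨ cong₂ _+_ (dot-A-probe n w₀ t w∈A) (dot-A-probe n w₀ t w∈A) ⟨
  dot (A-probe n) (w₀ ∷ t) + dot (A-probe n) (w₀ ∷ t) ≡⟨ twice ⟩
  + (suc n ℕ.* n)                                     ≡⟨ ℤ.pos-* (suc n) n ⟩
  + suc n * + n                                       ∎)

A-half-rank≤1 : ∀ m (t : Vecℤ (m ℕ.+ m)) → member (A (m ℕ.+ m)) (+ m ∷ t) →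
                DotsDivisibleBy (A (m ℕ.+ m)) (+ suc (m ℕ.+ m)) (+ m ∷ t) →
                dot (+ m ∷ t) (+ m ∷ t) ≡ + (suc (m ℕ.+ m) ℕ.* (m ℕ.+ m)) → m ≡ 0 ⊎ m ≡ 1
A-half-rank≤1 m t w∈A w∣ ww = m[m+1]≤2m⇒m≤1 m (ℕ.*-cancelˡ-≤ {m ℕ.* m ℕ.+ 1 ℕ.* m} {m ℕ.+ m} N bound)
  where
  N  = suc (m ℕ.+ m)
  w  = + m ∷ t
  congruent = norm-congruence m 1 w (coordinates≡head-mod (_≡ + 0) refl (+ m) t w∣)
  J  = proj₁ congruent
  norm≡ : N ℕ.* (m ℕ.* m ℕ.+ 1 ℕ.* m) ℕ.+ N ℕ.* N ℕ.* J ≡ N ℕ.* (m ℕ.+ m)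
  norm≡ = trans (ℤ.+-injective (trans (sym (proj₂ congruent)) (cong₂ _+_ ww (cong (_*_ (+ 1)) w∈A))))
                (ℕ.+-identityʳ _)
  bound : N ℕ.* (m ℕ.* m ℕ.+ 1 ℕ.* m) ℕ.≤ N ℕ.* (m ℕ.+ m)
  bound = ℕ.≤-trans (ℕ.m≤m+n (N ℕ.* (m ℕ.* m ℕ.+ 1 ℕ.* m)) (N ℕ.* N ℕ.* J)) (ℕ.≤-reflexive norm≡)

A-image-rank∈02 : ∀ n (w : Vecℤ (suc n)) → member (A n) w →
                  dot (A-probe n) w + dot (A-probe n) w ≡ + (suc n ℕ.* n) →
                  DotsDivisibleBy (A n) (+ suc n) w → dot w w ≡ + (suc n ℕ.* n) →
                  n ≡ 0 ⊎ n ≡ 2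
A-image-rank∈02 n (w₀ ∷ t) w∈A twice w∣ ww with half w₀ n (A-first≡half n w₀ t w∈A twice)
... | m , refl , refl =
  Data.Sum.map (cong (λ k → k ℕ.+ k)) (cong (λ k → k ℕ.+ k)) (A-half-rank≤1 m t w∈A w∣ ww)

A-cyc6⇒rank∈02 : ∀ n (g : Aut (A n)) → Annihilates (A n) cyc6 g → n ≡ 0 ⊎ n ≡ 2
A-cyc6⇒rank∈02 n g ann =
  A-image-rank∈02 n (fun g y) (closed g y y∈A) (trans (twice-dot-image≡norm g ann y∈A) (A-probe-norm n))
    (image-DotsDivisibleBy g y∈A (A-probe-DotsDivisibleBy-rank+1 n))
    (trans (isometry g y y y∈A y∈A) (A-probe-norm n))
  where
  y   = A-probe n
  y∈A = A-probe∈A n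

same-parity⇒sum-even : ∀ a b →
  (+ 2 Unsigned.∣ a) × (+ 2 Unsigned.∣ b) ⊎ (+ 2 Unsigned.∣ a + + 1) × (+ 2 Unsigned.∣ b + + 1) →
  + 2 ∣ a + b
same-parity⇒sum-even a b (inj₁ (2∣a , 2∣b)) =
  ∣m∣n⇒∣m+n (∣ᵤ⇒∣ {+ 2} {a} 2∣a) (∣ᵤ⇒∣ {+ 2} {b} 2∣b)
same-parity⇒sum-even a b (inj₂ (2∣a+1 , 2∣b+1)) =
  subst (+ 2 ∣_) (shift a b)
    (∣m∣n⇒∣m-n (∣m∣n⇒∣m+n (∣ᵤ⇒∣ {+ 2} {a + + 1} 2∣a+1) (∣ᵤ⇒∣ {+ 2} {b + + 1} 2∣b+1)) ∣-refl)
  where shift : ∀ a b → (a + + 1) + (b + + 1) - + 2 ≡ a + b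
        shift = solve-∀

-- (1,1,1,1,1,1,-3,-3)/2 in the doubled coordinates of E7.
E7-probe : Vecℤ 8
E7-probe = + 1 ∷ + 1 ∷ + 1 ∷ + 1 ∷ + 1 ∷ + 1 ∷ - (+ 3) ∷ - (+ 3) ∷ []

E7-probe∈E7 : member E7 E7-probe
E7-probe∈E7 = refl , inj₂ (odd ∷ odd ∷ odd ∷ odd ∷ odd ∷ odd ∷ Unsigned.divides 1 refl ∷ Unsigned.divides 1 refl ∷ [])
  where odd : + 2 Unsigned.∣ + 1 + + 1
        odd = Unsigned.divides 1 refl

E7-probe-DotsDivisibleBy-8 : DotsDivisibleBy E7 (+ 8) E7-probe
E7-probe-DotsDivisibleBy-8 w@(a₁ ∷ a₂ ∷ a₃ ∷ a₄ ∷ a₅ ∷ a₆ ∷ a₇ ∷ a₈ ∷ []) (Σw≡0 , parity)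
  with same-parity⇒sum-even a₇ a₈ (Data.Sum.map last-two last-two parity)
  where
  last-two : ∀ {P : ℤ → Set} → All P w → P a₇ × P a₈
  last-two (_ ∷ _ ∷ _ ∷ _ ∷ _ ∷ _ ∷ p₇ ∷ p₈ ∷ []) = p₇ , p₈
... | divides r a₇+a₈≡2r = divides (- r) (begin
  dot E7-probe w                 ≡⟨ expand a₁ a₂ a₃ a₄ a₅ a₆ a₇ a₈ ⟩
  vsum w - + 4 * (a₇ + a₈)       ≡⟨ cong₂ (λ s p → s - + 4 * p) Σw≡0 a₇+a₈≡2r ⟩
  + 0 - + 4 * (r * + 2)          ≡⟨ collect r ⟩
  - r * + 8                      ∎)
  where
  expand : ∀ a₁ a₂ a₃ a₄ a₅ a₆ a₇ a₈ →
    + 1 * a₁ + (+ 1 * a₂ + (+ 1 * a₃ + (+ 1 * a₄ + (+ 1 * a₅ + (+ 1 * a₆ + (- (+ 3) * a₇ + (- (+ 3) * a₈ + + 0))))))) ≡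
    (a₁ + (a₂ + (a₃ + (a₄ + (a₅ + (a₆ + (a₇ + (a₈ + + 0)))))))) - + 4 * (a₇ + a₈)
  expand = solve-∀
  collect : ∀ r → + 0 - + 4 * (r * + 2) ≡ - r * + 8
  collect = solve-∀

16∤24 : ¬ + 16 ∣ + 24
16∤24 16∣24 = from-no (16 ℕ.∣? 24) (∣⇒∣ᵤ 16∣24)

E7-no-cyc6 : (g : Aut E7) → ¬ Annihilates E7 cyc6 g
E7-no-cyc6 g ann with E7-probe-DotsDivisibleBy-8 (fun g E7-probe) (closed g E7-probe E7-probe∈E7)
... | divides q y·gy≡8q = 16∤24 (divides q (begin
  + 24                                                          ≡⟨ twice-dot-image≡norm g ann E7-probe∈E7 ⟨
  dot E7-probe (fun g E7-probe) + dot E7-probe (fun g E7-probe) ≡⟨ cong₂ _+_ y·gy≡8q y·gy≡8q ⟩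
  q * + 8 + q * + 8                                             ≡⟨ double q ⟩
  q * + 16                                                      ∎))
  where double : ∀ q → q * + 8 + q * + 8 ≡ q * + 16
        double = solve-∀

corollary2 : (∀ (n : ℕ) → 1 ≤ n → n ≢ 2 → ¬ Σ (Aut (A n)) (λ g → IsMinPoly (A n) g cyc6)) ×
    (∀ (n : ℕ) → 1 ≤ n → n ≢ 4 → ¬ Σ (Aut (D n)) (λ g → IsMinPoly (D n) g cyc6)) ×
    (¬ Σ (Aut E7) (λ g → IsMinPoly E7 g cyc6))
corollary2 = no-A , no-D , no-E7
  where
  no-A : ∀ (n : ℕ) → 1 ≤ n → n ≢ 2 → ¬ Σ (Aut (A n)) (λ g → IsMinPoly (A n) g cyc6)
  no-A n 1≤n n≢2 (g , _ , ann , _) with A-cyc6⇒rank∈02 n g ann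
  ... | inj₁ refl = ℕ.<-irrefl refl 1≤n
  ... | inj₂ n≡2  = n≢2 n≡2
  no-D : ∀ (n : ℕ) → 1 ≤ n → n ≢ 4 → ¬ Σ (Aut (D n)) (λ g → IsMinPoly (D n) g cyc6)
  no-D (suc n) _ n≢4 (g , _ , ann , _) = n≢4 (D-cyc6⇒rank≡4 n g ann)
  no-E7 : ¬ Σ (Aut E7) (λ g → IsMinPoly E7 g cyc6)
  no-E7 (g , _ , ann , _) = E7-no-cyc6 g ann
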